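{- For every graph $H$ (on $m\ge 1$ vertices, i.e. any spanning subgraph of $K_m$), the neighbourhood corona $K_3\star H$ is Class $1$, i.e. $\pi(K_3\star H)=|V(K_3\star H)|+1$.
   Context: For a simple graph $G=(V,E)$, a configuration is a function $\phi:V\to\mathbb{N}\cup\{0\}$; its size is $\sum_{u\in V}\phi(u)$. A pebbling step from a vertex $u$ to a neighbour $v$ removes two pebbles from $u$ and adds one pebble to $v$. For a target $r$, $\phi$ is $r$-solvable if some sequence of pebbling steps places at least one pebble on $r$. $\pi(G,r)$ is the minimum positive integer $m$ such that every configuration of size $m$ is $r$-solvable, and $\pi(G)=\max_{r\in V}\pi(G,r)$. $G$ is Class $1$ if $\pi(G)=|V(G)|+1$. The neighbourhood corona $G\star H$ is obtained from one copy of $G$ and $|V(G)|$ copies of $H$ by joining every neighbour (in $G$) of the $i$-th vertex of $G$ to every vertex of the $i$-th copy of $H$. -}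

module Defs where

open import Data.Nat using (ℕ; zero; suc; _+_; _*_; _∸_; _≤_; _<_)
open import Data.Fin using (Fin; splitAt; remQuot)
open import Data.Fin.Properties using (_≟_)
open import Data.Sum using (_⊎_; inj₁; inj₂)
open import Data.Product using (Σ; ∃; _×_; _,_; proj₁; proj₂)
open import Data.Empty using (⊥)
open import Relation.Nullary using (¬_; yes; no)
open import Relation.Binary.PropositionalEquality using (_≡_; _≢_)
open import Relation.Binary.Construct.Closure.ReflexiveTransitive using (Star)

record Graph (n : ℕ) : Set₁ where
  field
    Adj    : Fin n → Fin n → Set
    sym    : ∀ {u v} → Adj u v → Adj v u
    irrefl : ∀ {u} → ¬ Adj u u
open Graph public

Config : ℕ → Set
Config n = Fin n → ℕ

sumFin : ∀ n → (Fin n → ℕ) → ℕ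
sumFin zero    f = 0
sumFin (suc n) f = f Fin.zero + sumFin n (λ i → f (Fin.suc i))

size : ∀ {n} → Config n → ℕ
size {n} φ = sumFin n φ

afterStep : ∀ {n} → Fin n → Fin n → Config n → Config n
afterStep u v φ w with w ≟ u | w ≟ v
... | yes _ | _     = φ w ∸ 2
... | no _  | yes _ = suc (φ w)
... | no _  | no _  = φ w

PebStep : ∀ {n} → Graph n → Config n → Config n → Set
PebStep {n} G φ ψ =
  Σ (Fin n) λ u → Σ (Fin n) λ v →
    Adj G u v × 2 ≤ φ u × (∀ w → ψ w ≡ afterStep u v φ w)

Solvable : ∀ {n} → Graph n → Fin n → Config n → Set
Solvable G r φ = ∃ λ ψ → Star (PebStep G) φ ψ × 1 ≤ ψ r

IsPebblingNumberAt : ∀ {n} → Graph n → Fin n → ℕ → Set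
IsPebblingNumberAt {n} G r p =
  1 ≤ p
  × (∀ (φ : Config n) → size φ ≡ p → Solvable G r φ)
  × (∀ k → 1 ≤ k → k < p →
       ∃ λ (φ : Config n) → size φ ≡ k × ¬ Solvable G r φ)

IsPebblingNumber : ∀ {n} → Graph n → ℕ → Set
IsPebblingNumber {n} G p =
  (∀ r → ∃ λ q → IsPebblingNumberAt G r q × q ≤ p)
  × (∃ λ r → IsPebblingNumberAt G r p)

Class1 : ∀ {n} → Graph n → Set
Class1 {n} G = IsPebblingNumber G (suc n)

K : ∀ n → Graph n
K n = record { Adj = λ u v → u ≢ v ; sym = λ p q → p (Relation.Binary.PropositionalEquality.sym q) ; irrefl = λ p → p Relation.Binary.PropositionalEquality.refl }

-- Neighbourhood corona G ⋆ H.  Vertex set Fin (n + n * m):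
-- the first n vertices are those of G, a vertex in Fin (n * m) is
-- decoded by remQuot as (i , a) = vertex a of the i-th copy of H.
data CoronaAdj {n m} (G : Graph n) (H : Graph m) :
     Fin n ⊎ (Fin n × Fin m) → Fin n ⊎ (Fin n × Fin m) → Set where
  inG  : ∀ {i j} → Adj G i j → CoronaAdj G H (inj₁ i) (inj₁ j)
  inH  : ∀ {i a b} → Adj H a b → CoronaAdj G H (inj₂ (i , a)) (inj₂ (i , b))
  G→H  : ∀ {i j a} → Adj G i j → CoronaAdj G H (inj₁ i) (inj₂ (j , a))
  H→G  : ∀ {i j a} → Adj G i j → CoronaAdj G H (inj₂ (j , a)) (inj₁ i)

decode : ∀ n m → Fin (n + n * m) → Fin n ⊎ (Fin n × Fin m)
decode n m x with splitAt n x
... | inj₁ i = inj₁ i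
... | inj₂ y = inj₂ (remQuot m y)

private
  corSym : ∀ {n m} {G : Graph n} {H : Graph m} {x y} →
           CoronaAdj G H x y → CoronaAdj G H y x
  corSym {G = G} (inG p) = inG (Graph.sym G p)
  corSym {H = H} (inH p) = inH (Graph.sym H p)
  corSym (G→H p) = H→G p
  corSym (H→G p) = G→H p

  corIrr : ∀ {n m} {G : Graph n} {H : Graph m} {x} → ¬ CoronaAdj G H x x
  corIrr {G = G} (inG p) = Graph.irrefl G p
  corIrr {H = H} (inH p) = Graph.irrefl H p

_⋆_ : ∀ {n m} → Graph n → Graph m → Graph (n + n * m)
_⋆_ {n} {m} G H = record
  { Adj    = λ x y → CoronaAdj G H (decode n m x) (decode n m y)
  ; sym    = corSym
  ; irrefl = corIrr
  }

-- Let N = 3 + 3m be the order of K₃ ⋆ H, with hubs (the vertices of K₃) and copies of H.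
-- Upper bounds: a hub t can collect one pebble from every pebble pair sitting on a neighbour,
-- and the neighbourhoods of the hubs cover all pairs.  So if no hub adjacent to the target
-- can collect enough pebbles, counting pairs and the at most one odd pebble per copy vertex
-- shows the configuration has fewer than N pebbles (target a hub) or at most N pebbles
-- (target in a copy; here one extra strategy moves a pair of copy j onto a nonempty hub i).
-- Lower bounds: below N pebbles, one pebble on each non-target vertex is stuck.  With N
-- pebbles and target vertex a of copy i, put one pebble on every copy vertex except three on
-- vertex a of copies j and k and none on the target; a finite table of abstract states shows
-- that no vertex of copy i and neither hub j nor hub k ever holds two pebbles.

module Submission where

open import Defs hiding (sym)
open import Data.Bool using (Bool; true; false; if_then_else_; not)
open import Data.Empty using (⊥; ⊥-elim)
open import Data.Fin using (Fin; zero; suc; _↑ˡ_; _↑ʳ_; combine; splitAt)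
import Data.Fin.Properties as Fin
open import Data.Fin.Properties using (_≟_; splitAt-↑ˡ; remQuot-combine; combine-remQuot; join-splitAt)
import Data.Nat as ℕ
open import Data.Nat using (ℕ; zero; suc; _+_; _*_; _∸_; _≤_; _<_; z≤n; s≤s; _≤?_; ⌊_/2⌋)
open import Data.Nat.Properties
  using (+-identityʳ; +-suc; +-assoc; +-comm; *-zeroʳ; *-identityʳ; ≤-refl; ≤-trans; ≤-reflexive;
         ≤-pred; +-mono-≤; m≤m+n; m≤n+m; n≤0⇒n≡0; +-cancelʳ-≡; 1+n≰n; ≰⇒>; ∸-monoˡ-≤;
         m+n∸n≡m; m∸n+n≡m; <⇒≤; ≤∧≢⇒<; n≤1+n; <-irrefl; ≮⇒≥; suc-injective; module ≤-Reasoning)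
open import Data.Nat.Solver using (module +-*-Solver)
open import Data.Product using (∃; ∃₂; _×_; _,_; proj₁; proj₂)
open import Data.Sum using (_⊎_; inj₁; inj₂)
open import Function using (_∘_; case_of_)
open import Relation.Binary.PropositionalEquality
open import Relation.Binary.Construct.Closure.ReflexiveTransitive using (Star; ε; _◅_; _◅◅_)
open import Relation.Nullary using (¬_; yes; no; does)
open import Relation.Nullary.Decidable using (dec-true; dec-false; _×-dec_)

open +-*-Solver using (solve; _:=_; _:+_; _:*_; con)

private
  variable
    n : ℕ

parity : ℕ → ℕ
parity zero          = 0
parity (suc zero)    = 1
parity (suc (suc n)) = parity n

parity≤1 : ∀ n → parity n ≤ 1
parity≤1 zero          = z≤n
parity≤1 (suc zero)    = s≤s z≤n
parity≤1 (suc (suc n)) = parity≤1 n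

n≡parity+⌊n/2⌋+⌊n/2⌋ : ∀ n → n ≡ parity n + (⌊ n /2⌋ + ⌊ n /2⌋)
n≡parity+⌊n/2⌋+⌊n/2⌋ zero          = refl
n≡parity+⌊n/2⌋+⌊n/2⌋ (suc zero)    = refl
n≡parity+⌊n/2⌋+⌊n/2⌋ (suc (suc n)) =
  trans (cong (2 +_) (n≡parity+⌊n/2⌋+⌊n/2⌋ n))
        (solve 2 (λ p q → con 2 :+ (p :+ (q :+ q)) := p :+ ((con 1 :+ q) :+ (con 1 :+ q)))
               refl (parity n) ⌊ n /2⌋)

⌊n/2⌋≡1+⌊n∸2/2⌋ : ∀ {n} → 2 ≤ n → ⌊ n /2⌋ ≡ suc ⌊ n ∸ 2 /2⌋
⌊n/2⌋≡1+⌊n∸2/2⌋ (s≤s (s≤s _)) = refl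

1≤⌊n/2⌋⇒2≤n : ∀ n → 1 ≤ ⌊ n /2⌋ → 2 ≤ n
1≤⌊n/2⌋⇒2≤n (suc (suc n)) _ = s≤s (s≤s z≤n)

∸1≡0⇒≤1 : ∀ n → n ∸ 1 ≡ 0 → n ≤ 1
∸1≡0⇒≤1 zero          _ = z≤n
∸1≡0⇒≤1 (suc zero)    _ = s≤s z≤n
∸1≡0⇒≤1 (suc (suc n)) ()

2≤n⇒1≤n∸1 : ∀ {n} → 2 ≤ n → 1 ≤ n ∸ 1
2≤n⇒1≤n∸1 (s≤s (s≤s _)) = s≤s z≤n

n∸1≤2⇒n∸2≤1 : ∀ n → n ∸ 1 ≤ 2 → n ∸ 2 ≤ 1
n∸1≤2⇒n∸2≤1 (suc (suc n)) 1+n≤2 = ≤-pred 1+n≤2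
n∸1≤2⇒n∸2≤1 (suc zero)    _   = z≤n
n∸1≤2⇒n∸2≤1 zero          _   = z≤n

n∸1≤2⇒n∸2∸1≡0 : ∀ n → n ∸ 1 ≤ 2 → n ∸ 2 ∸ 1 ≡ 0
n∸1≤2⇒n∸2∸1≡0 n n∸1≤2 = n≤0⇒n≡0 (∸-monoˡ-≤ 1 (n∸1≤2⇒n∸2≤1 n n∸1≤2))

1≤n⇒1≤⌊1+n/2⌋ : ∀ {n} → 1 ≤ n → 1 ≤ ⌊ suc n /2⌋
1≤n⇒1≤⌊1+n/2⌋ (s≤s _) = s≤s z≤n

parity≤n : ∀ n → parity n ≤ n
parity≤n n = subst (parity n ≤_) (sym (n≡parity+⌊n/2⌋+⌊n/2⌋ n)) (m≤m+n _ _)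

bits-sum≤2 : ∀ {a b c} → a ≤ 1 → b ≤ 1 → c ≤ 1 → ¬ (1 ≤ a × 1 ≤ b × 1 ≤ c) → a + b + c ≤ 2
bits-sum≤2 z≤n b≤1 c≤1 _ = +-mono-≤ b≤1 c≤1
bits-sum≤2 (s≤s z≤n) z≤n c≤1 _ = s≤s c≤1
bits-sum≤2 (s≤s z≤n) (s≤s z≤n) z≤n _ = ≤-refl
bits-sum≤2 (s≤s z≤n) (s≤s z≤n) (s≤s z≤n) ¬all = ⊥-elim (¬all (≤-refl , ≤-refl , ≤-refl))

sumFin-cong : ∀ n {f g : Fin n → ℕ} → (∀ i → f i ≡ g i) → sumFin n f ≡ sumFin n g
sumFin-cong zero    f≗g = refl
sumFin-cong (suc n) f≗g = cong₂ _+_ (f≗g zero) (sumFin-cong n (f≗g ∘ suc))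

sumFin-+ : ∀ n (f g : Fin n → ℕ) → sumFin n (λ i → f i + g i) ≡ sumFin n f + sumFin n g
sumFin-+ zero    f g = refl
sumFin-+ (suc n) f g =
  trans (cong (f zero + g zero +_) (sumFin-+ n (f ∘ suc) (g ∘ suc)))
        (solve 4 (λ a b c d → (a :+ b) :+ (c :+ d) := (a :+ c) :+ (b :+ d))
               refl (f zero) (g zero) (sumFin n (f ∘ suc)) (sumFin n (g ∘ suc)))

sumFin-const : ∀ n c → sumFin n (λ _ → c) ≡ n * c
sumFin-const zero    c = refl
sumFin-const (suc n) c = cong (c +_) (sumFin-const n c)

sumFin-if : ∀ n (β : Bool) (f : Fin n → ℕ) →
            sumFin n (λ i → if β then f i else 0) ≡ (if β then sumFin n f else 0)
sumFin-if n true  f = refl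
sumFin-if n false f = trans (sumFin-const n 0) (*-zeroʳ n)

sumFin-mono : ∀ n {f g : Fin n → ℕ} → (∀ i → f i ≤ g i) → sumFin n f ≤ sumFin n g
sumFin-mono zero    f≤g = z≤n
sumFin-mono (suc n) f≤g = +-mono-≤ (f≤g zero) (sumFin-mono n (f≤g ∘ suc))

sumFin-≤1 : ∀ n (f : Fin n → ℕ) → (∀ i → f i ≤ 1) → sumFin n f ≤ n
sumFin-≤1 n f f≤1 = ≤-trans (sumFin-mono n f≤1) (≤-reflexive (trans (sumFin-const n 1) (*-identityʳ n)))

sumFin-≤1-with-hole : ∀ n (f : Fin n → ℕ) r → (∀ i → f i ≤ 1) → f r ≡ 0 → sumFin n f < n
sumFin-≤1-with-hole (suc n) f zero    f≤1 fr≡0 rewrite fr≡0 = s≤s (sumFin-≤1 n (f ∘ suc) (f≤1 ∘ suc))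
sumFin-≤1-with-hole (suc n) f (suc r) f≤1 fr≡0 =
  subst (_≤ suc n) (+-suc (f zero) _)
        (+-mono-≤ (f≤1 zero) (sumFin-≤1-with-hole n (f ∘ suc) r (f≤1 ∘ suc) fr≡0))

sumFin-update : ∀ n (f g : Fin n → ℕ) u → (∀ i → i ≢ u → f i ≡ g i) →
                sumFin n f + g u ≡ sumFin n g + f u
sumFin-update (suc n) f g zero f≗g
  rewrite sumFin-cong n {f ∘ suc} {g ∘ suc} (λ i → f≗g (suc i) λ ())
  = solve 3 (λ a b s → (a :+ s) :+ b := (b :+ s) :+ a) refl (f zero) (g zero) (sumFin n (g ∘ suc))
sumFin-update (suc n) f g (suc u) f≗g rewrite f≗g zero (λ ()) =
  trans (+-assoc (g zero) _ _)
 (trans (cong (g zero +_) (sumFin-update n (f ∘ suc) (g ∘ suc) u λ i i≢u → f≗g (suc i) (i≢u ∘ Fin.suc-injective)))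
        (sym (+-assoc (g zero) _ _)))

sumFin-↑ : ∀ a b (f : Fin (a + b) → ℕ) →
           sumFin (a + b) f ≡ sumFin a (f ∘ (_↑ˡ b)) + sumFin b (f ∘ (a ↑ʳ_))
sumFin-↑ zero    b f = refl
sumFin-↑ (suc a) b f = trans (cong (f zero +_) (sumFin-↑ a b (f ∘ suc))) (sym (+-assoc (f zero) _ _))

sumFin-combine : ∀ a b (f : Fin (a * b) → ℕ) →
                 sumFin (a * b) f ≡ sumFin a (λ i → sumFin b (λ j → f (combine i j)))
sumFin-combine zero    b f = refl
sumFin-combine (suc a) b f =
  trans (sumFin-↑ b (a * b) f) (cong (sumFin b (f ∘ (_↑ˡ a * b)) +_) (sumFin-combine a b (f ∘ (b ↑ʳ_))))

sumFin-positive : ∀ n (f : Fin n → ℕ) → 1 ≤ sumFin n f → ∃ λ i → 1 ≤ f i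
sumFin-positive (suc n) f pos with f zero in eq
... | suc _ = zero , subst (1 ≤_) (sym eq) (s≤s z≤n)
... | zero  with sumFin-positive n (f ∘ suc) pos
...   | i , fi = suc i , fi

sumFin-below : ∀ n (f : Fin n → ℕ) k → k ≤ sumFin n f →
               ∃ λ (g : Fin n → ℕ) → (∀ i → g i ≤ f i) × sumFin n g ≡ k
sumFin-below zero    f zero z≤n = f , (λ ()) , refl
sumFin-below (suc n) f k k≤ with k ≤? sumFin n (f ∘ suc)
... | yes k≤rest with sumFin-below n (f ∘ suc) k k≤rest
...   | g , g≤f , Σg = (λ { zero → 0 ; (suc i) → g i }) , (λ { zero → z≤n ; (suc i) → g≤f i }) , Σg
sumFin-below (suc n) f k k≤ | no k≰rest =
  (λ { zero → k ∸ sumFin n (f ∘ suc) ; (suc i) → f (suc i) }) ,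
  (λ { zero → subst (k ∸ sumFin n (f ∘ suc) ≤_) (m+n∸n≡m (f zero) (sumFin n (f ∘ suc)))
                    (∸-monoˡ-≤ (sumFin n (f ∘ suc)) k≤)
     ; (suc i) → ≤-refl }) ,
  m∸n+n≡m (<⇒≤ (≰⇒> k≰rest))

record IsStep {A : Set} (φ ψ : A → ℕ) (u v : A) : Set where
  field
    source : ψ u ≡ φ u ∸ 2
    target : ψ v ≡ suc (φ v)
    others : ∀ w → w ≢ u → w ≢ v → ψ w ≡ φ w

afterStep-isStep : ∀ {u v : Fin n} (φ : Config n) → u ≢ v → IsStep φ (afterStep u v φ) u v
afterStep-isStep {u = u} {v} φ u≢v = record { source = source ; target = target ; others = others }
  where
  source : afterStep u v φ u ≡ φ u ∸ 2
  source with u ≟ u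
  ... | yes _  = refl
  ... | no u≢u = ⊥-elim (u≢u refl)
  target : afterStep u v φ v ≡ suc (φ v)
  target with v ≟ u | v ≟ v
  ... | yes v≡u | _      = ⊥-elim (u≢v (sym v≡u))
  ... | no _    | yes _  = refl
  ... | no _    | no v≢v = ⊥-elim (v≢v refl)
  others : ∀ w → w ≢ u → w ≢ v → afterStep u v φ w ≡ φ w
  others w w≢u w≢v with w ≟ u | w ≟ v
  ... | yes w≡u | _       = ⊥-elim (w≢u w≡u)
  ... | no _    | yes w≡v = ⊥-elim (w≢v w≡v)
  ... | no _    | no _    = refl

adj⇒≢ : ∀ (G : Graph n) {u v} → Adj G u v → u ≢ v
adj⇒≢ G uv refl = irrefl G uv

PebStep⇒IsStep : ∀ (G : Graph n) {φ ψ : Config n} → PebStep G φ ψ →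
                 ∃₂ λ u v → Adj G u v × 2 ≤ φ u × IsStep φ ψ u v
PebStep⇒IsStep G {φ} {ψ} (u , v , uv , 2≤φu , ψ≗) = u , v , uv , 2≤φu , record
  { source = trans (ψ≗ u) source
  ; target = trans (ψ≗ v) target
  ; others = λ w w≢u w≢v → trans (ψ≗ w) (others w w≢u w≢v)
  }
  where open IsStep (afterStep-isStep φ (adj⇒≢ G uv))

Reach : Graph n → Config n → Fin n → ℕ → Set
Reach G φ t c = ∃ λ ψ → Star (PebStep G) φ ψ × c ≤ ψ t

Reach-step : ∀ (G : Graph n) {φ u v t c} → Adj G u v → 2 ≤ φ u →
             Reach G (afterStep u v φ) t c → Reach G φ t c
Reach-step G uv 2≤φu (ψ , steps , c≤ψt) = ψ , (_ , _ , uv , 2≤φu , (λ _ → refl)) ◅ steps , c≤ψt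

Reach⇒Solvable : ∀ (G : Graph n) {φ t r} → Adj G t r → Reach G φ t 2 → Solvable G r φ
Reach⇒Solvable G {t = t} {r} tr (ψ , steps , 2≤ψt) =
  afterStep t r ψ , steps ◅◅ ((t , r , tr , 2≤ψt , (λ _ → refl)) ◅ ε) ,
  subst (1 ≤_) (sym (IsStep.target (afterStep-isStep ψ (adj⇒≢ G tr)))) (s≤s z≤n)

pairsIn : (Fin n → Bool) → Config n → ℕ
pairsIn {n} S φ = sumFin n (λ w → if S w then ⌊ φ w /2⌋ else 0)

pairsIn-step : ∀ (S : Fin n → Bool) {φ ψ u v} → S u ≡ true → S v ≡ false → 2 ≤ φ u →
               IsStep φ ψ u v → pairsIn S φ ≡ suc (pairsIn S ψ)
pairsIn-step {n} S {φ} {ψ} {u} {v} Su Sv 2≤φu step =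
  +-cancelʳ-≡ _ _ _ (begin
    pairsIn S φ + ⌊ φ u ∸ 2 /2⌋         ≡⟨ cong (pairsIn S φ +_) (sym pairsAt-u) ⟩
    pairsIn S φ + pairsAt ψ u           ≡⟨ sym (sumFin-update n (pairsAt ψ) (pairsAt φ) u agree) ⟩
    pairsIn S ψ + pairsAt φ u           ≡⟨ cong (pairsIn S ψ +_) (trans (cong (if_then ⌊ φ u /2⌋ else 0) Su)
                                                                      (⌊n/2⌋≡1+⌊n∸2/2⌋ 2≤φu)) ⟩
    pairsIn S ψ + suc ⌊ φ u ∸ 2 /2⌋     ≡⟨ +-suc _ _ ⟩
    suc (pairsIn S ψ) + ⌊ φ u ∸ 2 /2⌋   ∎)
  where
  open ≡-Reasoning
  open IsStep step
  pairsAt : Config n → Fin n → ℕ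
  pairsAt χ w = if S w then ⌊ χ w /2⌋ else 0
  pairsAt-u : pairsAt ψ u ≡ ⌊ φ u ∸ 2 /2⌋
  pairsAt-u rewrite Su = cong ⌊_/2⌋ source
  agree : ∀ w → w ≢ u → pairsAt ψ w ≡ pairsAt φ w
  agree w w≢u with S w in Sw
  ... | false = refl
  ... | true  = cong ⌊_/2⌋ (others w w≢u λ { refl → case trans (sym Sw) Sv of λ () })

gather : ∀ (G : Graph n) t (S : Fin n → Bool) → (∀ w → S w ≡ true → Adj G w t) →
         ∀ φ c → c ≤ φ t + pairsIn S φ → Reach G φ t c
gather {n} G t S S⊆N φ c c≤ = go (pairsIn S φ) φ refl c≤
  where
  St : S t ≡ false
  St with S t in eq
  ... | false = refl
  ... | true  = ⊥-elim (irrefl G (S⊆N t eq))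
  go : ∀ d φ → pairsIn S φ ≡ d → c ≤ φ t + d → Reach G φ t c
  go zero    φ _  c≤ = φ , ε , subst (c ≤_) (+-identityʳ (φ t)) c≤
  go (suc d) φ Σ≡ c≤ with sumFin-positive n _ (subst (1 ≤_) (sym Σ≡) (s≤s z≤n))
  ... | w , pos with S w in Sw
  ...   | false = ⊥-elim (1+n≰n pos)
  ...   | true  = Reach-step G (S⊆N w Sw) 2≤φw (go d (afterStep w t φ) Σ′≡ c≤′)
    where
    2≤φw = 1≤⌊n/2⌋⇒2≤n (φ w) pos
    step = afterStep-isStep φ (adj⇒≢ G (S⊆N w Sw))
    Σ′≡ : pairsIn S (afterStep w t φ) ≡ d
    Σ′≡ = suc-injective (trans (sym (pairsIn-step S Sw St 2≤φw step)) Σ≡)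
    c≤′ : c ≤ afterStep w t φ t + d
    c≤′ rewrite IsStep.target step = subst (c ≤_) (+-suc (φ t) d) c≤

unsolvable-by-invariant : ∀ (G : Graph n) r (P : Config n → Set) →
  (∀ {φ ψ} → PebStep G φ ψ → P φ → P ψ) → (∀ {φ} → P φ → φ r ≡ 0) →
  ∀ {φ} → P φ → ¬ Solvable G r φ
unsolvable-by-invariant G r P preserved empty Pφ (ψ , steps , 1≤ψr) =
  1+n≰n (subst (1 ≤_) (empty (invariant steps Pφ)) 1≤ψr)
  where
  invariant : ∀ {φ ψ} → Star (PebStep G) φ ψ → P φ → P ψ
  invariant ε          Pφ = Pφ
  invariant (s ◅ rest) Pφ = invariant rest (preserved s Pφ)

unsolvable-below : ∀ (G : Graph n) r k → k < n → ∃ λ φ → size φ ≡ k × ¬ Solvable G r φ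
unsolvable-below {n} G r k k<n =
  φ , size≡k ,
  unsolvable-by-invariant G r Sparse
    (λ { (u , _ , _ , 2≤χu , _) (χ≤1 , _) → ⊥-elim (1+n≰n (≤-trans 2≤χu (χ≤1 u))) })
    proj₂
    ((λ w → ≤-trans (φ≤spread w) (spread≤1 w)) , n≤0⇒n≡0 (≤-trans (φ≤spread r) (≤-reflexive spread-r)))
  where
  Sparse : Config n → Set
  Sparse χ = (∀ w → χ w ≤ 1) × χ r ≡ 0
  spread : Config n
  spread w = if does (w ≟ r) then 0 else 1
  spread≤1 : ∀ w → spread w ≤ 1
  spread≤1 w with w ≟ r
  ... | yes _ = z≤n
  ... | no _  = s≤s z≤n
  spread-r : spread r ≡ 0
  spread-r rewrite dec-true (r ≟ r) refl = refl
  k≤Σspread : k ≤ sumFin n spread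
  k≤Σspread = ≤-pred (subst (suc k ≤_) (sym Σspread+1) k<n)
    where
    Σspread+1 : suc (sumFin n spread) ≡ n
    Σspread+1 = begin
      suc (sumFin n spread)           ≡⟨ +-comm 1 _ ⟩
      sumFin n spread + 1             ≡⟨ sumFin-update n spread (λ _ → 1) r
                                           (λ w w≢r → cong (if_then 0 else 1) (dec-false (w ≟ r) w≢r)) ⟩
      sumFin n (λ _ → 1) + spread r   ≡⟨ cong₂ _+_ (trans (sumFin-const n 1) (*-identityʳ n)) spread-r ⟩
      n + 0                           ≡⟨ +-identityʳ n ⟩
      n                               ∎
      where open ≡-Reasoning
  φ : Config n
  φ = proj₁ (sumFin-below n spread k k≤Σspread)
  φ≤spread : ∀ w → φ w ≤ spread w
  φ≤spread = proj₁ (proj₂ (sumFin-below n spread k k≤Σspread))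
  size≡k : size φ ≡ k
  size≡k = proj₂ (proj₂ (sumFin-below n spread k k≤Σspread))

-- Orderings (i , j , k) of the vertices of K₃

pattern #0 = zero
pattern #1 = suc zero
pattern #2 = suc (suc zero)

data Frame : Fin 3 → Fin 3 → Fin 3 → Set where
  f012 : Frame #0 #1 #2
  f021 : Frame #0 #2 #1
  f102 : Frame #1 #0 #2
  f120 : Frame #1 #2 #0
  f201 : Frame #2 #0 #1
  f210 : Frame #2 #1 #0

private
  variable
    i j k : Fin 3

Frame-swap : Frame i j k → Frame i k j
Frame-swap f012 = f021
Frame-swap f021 = f012
Frame-swap f102 = f120
Frame-swap f120 = f102
Frame-swap f201 = f210
Frame-swap f210 = f201

Frame-transpose : Frame i j k → Frame j i k
Frame-transpose f012 = f102
Frame-transpose f021 = f201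
Frame-transpose f102 = f012
Frame-transpose f120 = f210
Frame-transpose f201 = f021
Frame-transpose f210 = f120

Frame-for : ∀ i → ∃₂ (Frame i)
Frame-for #0 = _ , _ , f012
Frame-for #1 = _ , _ , f102
Frame-for #2 = _ , _ , f201

Frame-i≢j : Frame i j k → i ≢ j
Frame-i≢j f012 ()
Frame-i≢j f021 ()
Frame-i≢j f102 ()
Frame-i≢j f120 ()
Frame-i≢j f201 ()
Frame-i≢j f210 ()

Frame-j≢i : Frame i j k → j ≢ i
Frame-j≢i = Frame-i≢j ∘ Frame-transpose

Frame-i≢k : Frame i j k → i ≢ k
Frame-i≢k = Frame-i≢j ∘ Frame-swap

Frame-k≢i : Frame i j k → k ≢ i
Frame-k≢i = Frame-j≢i ∘ Frame-swap

Frame-j≢k : Frame i j k → j ≢ k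
Frame-j≢k = Frame-i≢k ∘ Frame-transpose

Frame-k≢j : Frame i j k → k ≢ j
Frame-k≢j = Frame-j≢k ∘ Frame-swap

Frame-cover : Frame i j k → ∀ p → p ≡ i ⊎ p ≡ j ⊎ p ≡ k
Frame-cover f012 #0 = inj₁ refl
Frame-cover f012 #1 = inj₂ (inj₁ refl)
Frame-cover f012 #2 = inj₂ (inj₂ refl)
Frame-cover f021 #0 = inj₁ refl
Frame-cover f021 #1 = inj₂ (inj₂ refl)
Frame-cover f021 #2 = inj₂ (inj₁ refl)
Frame-cover f102 #0 = inj₂ (inj₁ refl)
Frame-cover f102 #1 = inj₁ refl
Frame-cover f102 #2 = inj₂ (inj₂ refl)
Frame-cover f120 #0 = inj₂ (inj₂ refl)
Frame-cover f120 #1 = inj₁ refl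
Frame-cover f120 #2 = inj₂ (inj₁ refl)
Frame-cover f201 #0 = inj₂ (inj₁ refl)
Frame-cover f201 #1 = inj₂ (inj₂ refl)
Frame-cover f201 #2 = inj₁ refl
Frame-cover f210 #0 = inj₂ (inj₂ refl)
Frame-cover f210 #1 = inj₂ (inj₁ refl)
Frame-cover f210 #2 = inj₁ refl

sum-Frame : Frame i j k → ∀ (f : Fin 3 → ℕ) → sumFin 3 f ≡ f i + f j + f k
sum-Frame fr f = go fr
  where
  go : Frame i j k → sumFin 3 f ≡ f i + f j + f k
  go f012 = solve 3 (λ a b c → a :+ (b :+ (c :+ con 0)) := a :+ b :+ c) refl (f #0) (f #1) (f #2)
  go f021 = solve 3 (λ a b c → a :+ (b :+ (c :+ con 0)) := a :+ c :+ b) refl (f #0) (f #1) (f #2)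
  go f102 = solve 3 (λ a b c → a :+ (b :+ (c :+ con 0)) := b :+ a :+ c) refl (f #0) (f #1) (f #2)
  go f120 = solve 3 (λ a b c → a :+ (b :+ (c :+ con 0)) := b :+ c :+ a) refl (f #0) (f #1) (f #2)
  go f201 = solve 3 (λ a b c → a :+ (b :+ (c :+ con 0)) := c :+ a :+ b) refl (f #0) (f #1) (f #2)
  go f210 = solve 3 (λ a b c → a :+ (b :+ (c :+ con 0)) := c :+ b :+ a) refl (f #0) (f #1) (f #2)

sum-Frame-others : Frame i j k → ∀ (f : Fin 3 → ℕ) →
                   sumFin 3 (λ p → if not (does (p ≟ i)) then f p else 0) ≡ f j + f k
sum-Frame-others {i} fr f = begin
  sumFin 3 g                      ≡⟨ sum-Frame fr g ⟩
  g i + g _ + g _                 ≡⟨ cong₂ _+_ (cong₂ _+_ gi (g-other (Frame-j≢i fr))) (g-other (Frame-k≢i fr)) ⟩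
  f _ + f _                       ∎
  where
  open ≡-Reasoning
  g : Fin 3 → ℕ
  g p = if not (does (p ≟ i)) then f p else 0
  gi : g i ≡ 0
  gi rewrite dec-true (i ≟ i) refl = refl
  g-other : ∀ {p} → p ≢ i → g p ≡ f p
  g-other {p} p≢i rewrite dec-false (p ≟ i) p≢i = refl

-- Safe x y z b c abstracts a configuration reachable from the extremal one for the target
-- copy i a: the hubs i, j, k hold x, y, z pebbles, and b = φ w ∸ 1, c = φ w′ ∸ 1 for the one
-- vertex w of copy j, resp. w′ of copy k, that may hold more than one pebble.  The start is
-- (0 , 0 , 0 , 2 , 2), and the table is closed under every possible step (Invariant-step).
data Safe : ℕ → ℕ → ℕ → ℕ → ℕ → Set where
  S00000 : Safe 0 0 0 0 0
  S00001 : Safe 0 0 0 0 1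
  S00002 : Safe 0 0 0 0 2
  S00010 : Safe 0 0 0 1 0
  S00011 : Safe 0 0 0 1 1
  S00012 : Safe 0 0 0 1 2
  S00020 : Safe 0 0 0 2 0
  S00021 : Safe 0 0 0 2 1
  S00022 : Safe 0 0 0 2 2
  S00100 : Safe 0 0 1 0 0
  S00101 : Safe 0 0 1 0 1
  S00102 : Safe 0 0 1 0 2
  S01000 : Safe 0 1 0 0 0
  S01010 : Safe 0 1 0 1 0
  S01020 : Safe 0 1 0 2 0
  S01100 : Safe 0 1 1 0 0
  S10000 : Safe 1 0 0 0 0
  S10001 : Safe 1 0 0 0 1
  S10002 : Safe 1 0 0 0 2
  S10010 : Safe 1 0 0 1 0
  S10020 : Safe 1 0 0 2 0
  S10100 : Safe 1 0 1 0 0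
  S11000 : Safe 1 1 0 0 0
  S20000 : Safe 2 0 0 0 0

module _ where

  private
    variable
      x y z b c e x′ y′ z′ b′ c′ : ℕ

  Safe-resp : x ≡ x′ → y ≡ y′ → z ≡ z′ → b ≡ b′ → c ≡ c′ → Safe x y z b c → Safe x′ y′ z′ b′ c′
  Safe-resp refl refl refl refl refl s = s

  Safe-swap : Safe x y z b c → Safe x z y c b
  Safe-swap S00000 = S00000
  Safe-swap S00001 = S00010
  Safe-swap S00002 = S00020
  Safe-swap S00010 = S00001
  Safe-swap S00011 = S00011
  Safe-swap S00012 = S00021
  Safe-swap S00020 = S00002
  Safe-swap S00021 = S00012
  Safe-swap S00022 = S00022
  Safe-swap S00100 = S01000
  Safe-swap S00101 = S01010
  Safe-swap S00102 = S01020
  Safe-swap S01000 = S00100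
  Safe-swap S01010 = S00101
  Safe-swap S01020 = S00102
  Safe-swap S01100 = S01100
  Safe-swap S10000 = S10000
  Safe-swap S10001 = S10010
  Safe-swap S10002 = S10020
  Safe-swap S10010 = S10001
  Safe-swap S10020 = S10002
  Safe-swap S10100 = S11000
  Safe-swap S11000 = S10100
  Safe-swap S20000 = S20000

  Safe-no-pair-j : 2 ≤ y → ¬ Safe x y z b c
  Safe-no-pair-j (s≤s (s≤s _)) ()

  Safe-no-pair-k : 2 ≤ z → ¬ Safe x y z b c
  Safe-no-pair-k 2≤z = Safe-no-pair-j 2≤z ∘ Safe-swap

  Safe-surplus≤2 : 3 ≤ b → ¬ Safe x y z b c
  Safe-surplus≤2 (s≤s (s≤s (s≤s _))) ()

  Safe-hub-pair : 2 ≤ x → Safe x y z b c → b ≡ 0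
  Safe-hub-pair (s≤s (s≤s _)) S20000 = refl

  Safe-hub→hub : 2 ≤ x → Safe x y z b c → Safe (x ∸ 2) (suc y) z b c
  Safe-hub→hub (s≤s (s≤s _)) S20000 = S01000

  Safe-hub→copy : 2 ≤ x → Safe x y z b c → Safe (x ∸ 2) y z 1 c
  Safe-hub→copy (s≤s (s≤s _)) S20000 = S00010

  Safe-copy→hub : 1 ≤ b → Safe x y z b c → Safe (suc x) y z 0 c
  Safe-copy→hub (s≤s _) S00010 = S10000
  Safe-copy→hub (s≤s _) S00011 = S10001
  Safe-copy→hub (s≤s _) S00012 = S10002
  Safe-copy→hub (s≤s _) S00020 = S10000
  Safe-copy→hub (s≤s _) S00021 = S10001
  Safe-copy→hub (s≤s _) S00022 = S10002
  Safe-copy→hub (s≤s _) S01010 = S11000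
  Safe-copy→hub (s≤s _) S01020 = S11000
  Safe-copy→hub (s≤s _) S10010 = S20000
  Safe-copy→hub (s≤s _) S10020 = S20000

  Safe-copy→other-hub : 1 ≤ b → Safe x y z b c → Safe x y (suc z) 0 c
  Safe-copy→other-hub (s≤s _) S00010 = S00100
  Safe-copy→other-hub (s≤s _) S00011 = S00101
  Safe-copy→other-hub (s≤s _) S00012 = S00102
  Safe-copy→other-hub (s≤s _) S00020 = S00100
  Safe-copy→other-hub (s≤s _) S00021 = S00101
  Safe-copy→other-hub (s≤s _) S00022 = S00102
  Safe-copy→other-hub (s≤s _) S01010 = S01100
  Safe-copy→other-hub (s≤s _) S01020 = S01100
  Safe-copy→other-hub (s≤s _) S10010 = S10100
  Safe-copy→other-hub (s≤s _) S10020 = S10100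

  Safe-pred : Safe x y z (suc b) c → Safe x y z b c
  Safe-pred S00010 = S00000
  Safe-pred S00011 = S00001
  Safe-pred S00012 = S00002
  Safe-pred S00020 = S00010
  Safe-pred S00021 = S00011
  Safe-pred S00022 = S00012
  Safe-pred S01010 = S01000
  Safe-pred S01020 = S01010
  Safe-pred S10010 = S10000
  Safe-pred S10020 = S10010

  Safe-≤ : e ≤ b → Safe x y z b c → Safe x y z e c
  Safe-≤ {e} {zero}  z≤n s = s
  Safe-≤ {e} {suc b} e≤ s with e ℕ.≟ suc b
  ... | yes refl = s
  ... | no e≢    = Safe-≤ (≤-pred (≤∧≢⇒< e≤ e≢)) (Safe-pred s)

pattern hub p    = inj₁ p
pattern copy c b = inj₂ (c , b)

not-does⇒≢ : ∀ {p q : Fin 3} → not (does (p ≟ q)) ≡ true → p ≢ q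
not-does⇒≢ {p} {q} eq refl with trans (sym eq) (cong not (dec-true (p ≟ p) refl))
... | ()

module Corona (m : ℕ) (H : Graph m) where

  N : ℕ
  N = 3 + 3 * m

  G⋆ : Graph N
  G⋆ = K 3 ⋆ H

  V : Set
  V = Fin 3 ⊎ (Fin 3 × Fin m)

  copy≢hub : ∀ {c b p} → _≢_ {A = V} (copy c b) (hub p)
  copy≢hub ()

  hub≢copy : ∀ {c b p} → _≢_ {A = V} (hub p) (copy c b)
  hub≢copy ()

  enc : V → Fin N
  enc (hub p)    = p ↑ˡ 3 * m
  enc (copy c b) = 3 ↑ʳ combine c b

  dec : Fin N → V
  dec = decode 3 m

  dec∘enc : ∀ x → dec (enc x) ≡ x
  dec∘enc (hub p)    rewrite splitAt-↑ˡ 3 p (3 * m) = refl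
  dec∘enc (copy c b) rewrite remQuot-combine {3} {m} c b = refl

  enc∘dec : ∀ w → enc (dec w) ≡ w
  enc∘dec w with splitAt 3 w | join-splitAt 3 (3 * m) w
  ... | inj₁ p | join≡ = join≡
  ... | inj₂ y | join≡ = trans (cong (3 ↑ʳ_) (combine-remQuot {3} m y)) join≡

  enc-injective : ∀ {x y} → enc x ≡ enc y → x ≡ y
  enc-injective {x} {y} eq = trans (sym (dec∘enc x)) (trans (cong dec eq) (dec∘enc y))

  adj-enc : ∀ {x y} → CoronaAdj (K 3) H x y → Adj G⋆ (enc x) (enc y)
  adj-enc {x} {y} = subst₂ (CoronaAdj (K 3) H) (sym (dec∘enc x)) (sym (dec∘enc y))

  _at_ : Config N → V → ℕ
  φ at x = φ (enc x)

  IsStep-enc : ∀ {φ ψ : Config N} {x y} → IsStep φ ψ (enc x) (enc y) →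
               IsStep (φ ∘ enc) (ψ ∘ enc) x y
  IsStep-enc step = record
    { source = source
    ; target = target
    ; others = λ z z≢x z≢y → others (enc z) (z≢x ∘ enc-injective) (z≢y ∘ enc-injective)
    }
    where open IsStep step

  copySum pairs odds : Config N → Fin 3 → ℕ
  copySum φ c = sumFin m (λ b → φ at copy c b)
  pairs   φ c = sumFin m (λ b → ⌊ φ at copy c b /2⌋)
  odds    φ c = sumFin m (λ b → parity (φ at copy c b))

  copySum≡odds+pairs+pairs : ∀ φ c → copySum φ c ≡ odds φ c + (pairs φ c + pairs φ c)
  copySum≡odds+pairs+pairs φ c =
    trans (sumFin-cong m (λ b → n≡parity+⌊n/2⌋+⌊n/2⌋ (φ at copy c b)))
          (trans (sumFin-+ m _ _) (cong (odds φ c +_) (sumFin-+ m _ _)))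

  odds≤m : ∀ φ c → odds φ c ≤ m
  odds≤m φ c = sumFin-≤1 m _ (λ b → parity≤1 (φ at copy c b))

  sumFin-corona : ∀ (F : Fin N → ℕ) →
    sumFin N F ≡ sumFin 3 (λ p → F (enc (hub p))) + sumFin 3 (λ c → sumFin m (λ b → F (enc (copy c b))))
  sumFin-corona F =
    trans (sumFin-↑ 3 (3 * m) F) (cong (sumFin 3 (λ p → F (enc (hub p))) +_) (sumFin-combine 3 m (F ∘ (3 ↑ʳ_))))

  size-Frame : Frame i j k → ∀ φ →
    size φ ≡ (φ at hub i + φ at hub j + φ at hub k) + (copySum φ i + copySum φ j + copySum φ k)
  size-Frame fr φ = trans (sumFin-corona φ) (cong₂ _+_ (sum-Frame fr (λ p → φ at hub p)) (sum-Frame fr (copySum φ)))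

  -- Upper bounds

  hubNbr : Fin 3 → V → Bool
  hubNbr t (hub p)    = not (does (p ≟ t))
  hubNbr t (copy c _) = not (does (c ≟ t))

  hubNbr-adj : ∀ t x → hubNbr t x ≡ true → CoronaAdj (K 3) H x (hub t)
  hubNbr-adj t (hub p)    eq = inG (not-does⇒≢ eq)
  hubNbr-adj t (copy c b) eq = H→G (not-does⇒≢ eq ∘ sym)

  gatherable : Config N → Fin 3 → Fin 3 → Fin 3 → ℕ
  gatherable φ t u v = φ at hub t + (⌊ φ at hub u /2⌋ + ⌊ φ at hub v /2⌋ + (pairs φ u + pairs φ v))

  pairsIn-hubNbr : Frame i j k → ∀ φ →
    pairsIn (hubNbr i ∘ dec) φ ≡ ⌊ φ at hub j /2⌋ + ⌊ φ at hub k /2⌋ + (pairs φ j + pairs φ k)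
  pairsIn-hubNbr {i} {j} {k} fr φ = begin
    pairsIn (hubNbr i ∘ dec) φ
      ≡⟨ sumFin-corona F ⟩
    sumFin 3 (λ p → F (enc (hub p))) + sumFin 3 (λ c → sumFin m (λ b → F (enc (copy c b))))
      ≡⟨ cong₂ _+_ (sumFin-cong 3 (F-enc ∘ hub))
                   (sumFin-cong 3 (λ c → trans (sumFin-cong m (F-enc ∘ copy c))
                                               (sumFin-if m (not (does (c ≟ i))) (λ b → ⌊ φ at copy c b /2⌋)))) ⟩
    sumFin 3 (λ p → if not (does (p ≟ i)) then ⌊ φ at hub p /2⌋ else 0)
      + sumFin 3 (λ c → if not (does (c ≟ i)) then pairs φ c else 0)
      ≡⟨ cong₂ _+_ (sum-Frame-others fr (λ p → ⌊ φ at hub p /2⌋)) (sum-Frame-others fr (pairs φ)) ⟩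
    ⌊ φ at hub j /2⌋ + ⌊ φ at hub k /2⌋ + (pairs φ j + pairs φ k) ∎
    where
    open ≡-Reasoning
    F : Fin N → ℕ
    F w = if hubNbr i (dec w) then ⌊ φ w /2⌋ else 0
    F-enc : ∀ x → F (enc x) ≡ (if hubNbr i x then ⌊ φ at x /2⌋ else 0)
    F-enc x = cong (λ y → if hubNbr i y then ⌊ φ at x /2⌋ else 0) (dec∘enc x)

  gather-hub : Frame i j k → ∀ φ c → c ≤ gatherable φ i j k → Reach G⋆ φ (enc (hub i)) c
  gather-hub {i} fr φ c c≤ =
    gather G⋆ (enc (hub i)) (hubNbr i ∘ dec)
      (λ w eq → subst (CoronaAdj (K 3) H (dec w)) (sym (dec∘enc (hub i))) (hubNbr-adj i (dec w) eq))
      φ c (subst (λ s → c ≤ φ at hub i + s) (sym (pairsIn-hubNbr fr φ)) c≤)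

  hubsAndPairs : Config N → Fin 3 → Fin 3 → Fin 3 → ℕ
  hubsAndPairs φ i j k =
    φ at hub i + φ at hub j + φ at hub k + ((pairs φ i + pairs φ i) + (pairs φ j + pairs φ j) + (pairs φ k + pairs φ k))

  size≡hubsAndPairs+odds : Frame i j k → ∀ φ → size φ ≡ hubsAndPairs φ i j k + (odds φ i + odds φ j + odds φ k)
  size≡hubsAndPairs+odds {i} {j} {k} fr φ =
    trans (size-Frame fr φ)
   (trans (cong ((φ at hub i + φ at hub j + φ at hub k) +_)
                (cong₂ _+_ (cong₂ _+_ (copySum≡odds+pairs+pairs φ i) (copySum≡odds+pairs+pairs φ j))
                           (copySum≡odds+pairs+pairs φ k)))
          (solve 9 (λ x y z pi pj pk oi oj ok →
                      (x :+ y :+ z) :+ ((oi :+ (pi :+ pi)) :+ (oj :+ (pj :+ pj)) :+ (ok :+ (pk :+ pk)))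
                      := (x :+ y :+ z) :+ ((pi :+ pi) :+ (pj :+ pj) :+ (pk :+ pk)) :+ (oi :+ oj :+ ok))
                   refl (φ at hub i) (φ at hub j) (φ at hub k) (pairs φ i) (pairs φ j) (pairs φ k)
                   (odds φ i) (odds φ j) (odds φ k)))

  hubsAndPairs≤gatherable : ∀ φ i j k →
    hubsAndPairs φ i j k ≤ gatherable φ i j k + gatherable φ j i k + gatherable φ k i j
  hubsAndPairs≤gatherable φ i j k =
    ≤-trans (m≤m+n _ (hx + hx + (hy + hy) + (hz + hz))) (≤-reflexive
      (solve 9 (λ x y z hx hy hz pi pj pk →
                  x :+ y :+ z :+ ((pi :+ pi) :+ (pj :+ pj) :+ (pk :+ pk)) :+ (hx :+ hx :+ (hy :+ hy) :+ (hz :+ hz))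
                  := (x :+ (hy :+ hz :+ (pj :+ pk))) :+ (y :+ (hx :+ hz :+ (pi :+ pk))) :+ (z :+ (hx :+ hy :+ (pi :+ pj))))
               refl (φ at hub i) (φ at hub j) (φ at hub k) hx hy hz (pairs φ i) (pairs φ j) (pairs φ k)))
    where
    hx = ⌊ φ at hub i /2⌋ ; hy = ⌊ φ at hub j /2⌋ ; hz = ⌊ φ at hub k /2⌋

  hubsAndPairs≤gatherable-parity : ∀ φ i j k →
    hubsAndPairs φ i j k ≤ gatherable φ j i k + gatherable φ k i j + (parity (φ at hub i) + pairs φ j + pairs φ k)
  hubsAndPairs≤gatherable-parity φ i j k = begin
    x + y + z + pairs₂
      ≡⟨ cong (λ t → t + y + z + pairs₂) (n≡parity+⌊n/2⌋+⌊n/2⌋ x) ⟩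
    parity x + (hx + hx) + y + z + pairs₂
      ≤⟨ m≤m+n _ (hy + hz) ⟩
    parity x + (hx + hx) + y + z + pairs₂ + (hy + hz)
      ≡⟨ solve 9 (λ px hx y z hy hz pi pj pk →
                    px :+ (hx :+ hx) :+ y :+ z :+ ((pi :+ pi) :+ (pj :+ pj) :+ (pk :+ pk)) :+ (hy :+ hz)
                    := (y :+ (hx :+ hz :+ (pi :+ pk))) :+ (z :+ (hx :+ hy :+ (pi :+ pj))) :+ (px :+ pj :+ pk))
                 refl (parity x) hx y z hy hz (pairs φ i) (pairs φ j) (pairs φ k) ⟩
    gatherable φ j i k + gatherable φ k i j + (parity x + pairs φ j + pairs φ k) ∎
    where
    open ≤-Reasoning
    x = φ at hub i ; y = φ at hub j ; z = φ at hub k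
    hx = ⌊ x /2⌋ ; hy = ⌊ y /2⌋ ; hz = ⌊ z /2⌋
    pairs₂ = (pairs φ i + pairs φ i) + (pairs φ j + pairs φ j) + (pairs φ k + pairs φ k)

  ungatherable-hub-size : Frame i j k → ∀ φ →
    gatherable φ i j k ≤ 0 → gatherable φ j i k ≤ 1 → gatherable φ k i j ≤ 1 → size φ < N
  ungatherable-hub-size {i} {j} {k} fr φ gi≤0 gj≤1 gk≤1 = begin-strict
    size φ
      ≡⟨ size≡hubsAndPairs+odds fr φ ⟩
    hubsAndPairs φ i j k + (odds φ i + odds φ j + odds φ k)
      ≤⟨ +-mono-≤ (≤-trans (hubsAndPairs≤gatherable φ i j k) (+-mono-≤ (+-mono-≤ gi≤0 gj≤1) gk≤1))
                  (+-mono-≤ (+-mono-≤ (odds≤m φ i) (odds≤m φ j)) (odds≤m φ k)) ⟩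
    2 + (m + m + m)
      <⟨ ≤-refl ⟩
    suc (2 + (m + m + m))
      ≡⟨ cong (3 +_) (solve 1 (λ m → m :+ m :+ m := con 3 :* m) refl m) ⟩
    N ∎
    where open ≤-Reasoning

  hub-upper : Frame i j k → ∀ φ → size φ ≡ N → Solvable G⋆ (enc (hub i)) φ
  hub-upper {i} {j} {k} fr φ size≡N
    with 1 ≤? gatherable φ i j k | 2 ≤? gatherable φ j i k | 2 ≤? gatherable φ k i j
  ... | yes 1≤ | _      | _      = gather-hub fr φ 1 1≤
  ... | no _   | yes 2≤ | _      =
    Reach⇒Solvable G⋆ (adj-enc (inG (Frame-j≢i fr))) (gather-hub (Frame-transpose fr) φ 2 2≤)
  ... | no _   | no _   | yes 2≤ =
    Reach⇒Solvable G⋆ (adj-enc (inG (Frame-k≢i fr))) (gather-hub (Frame-transpose (Frame-swap fr)) φ 2 2≤)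
  ... | no 1≰i | no 2≰j | no 2≰k =
    ⊥-elim (<-irrefl size≡N (ungatherable-hub-size fr φ (≮⇒≥ 1≰i) (≮⇒≥ 2≰j) (≮⇒≥ 2≰k)))

  -- A pair from copy j turns the pebble on hub i into a pair for hub j.
  copy-via-hub : Frame i j k → ∀ a φ → 1 ≤ φ at hub i → 1 ≤ pairs φ j → 1 ≤ pairs φ k →
                 Solvable G⋆ (enc (copy i a)) φ
  copy-via-hub {i} {j} {k} fr a φ 1≤x 1≤pj 1≤pk with sumFin-positive m _ 1≤pj
  ... | b , 1≤⌊φb/2⌋ =
    Reach-step G⋆ (adj-enc (H→G (Frame-i≢j fr))) (1≤⌊n/2⌋⇒2≤n _ 1≤⌊φb/2⌋)
      (Reach⇒Solvable G⋆ (adj-enc (G→H (Frame-j≢i fr)))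
        (gather-hub (Frame-transpose fr) φ′ 2 (≤-trans (+-mono-≤ 1≤⌊x′/2⌋ 1≤pk′) two≤gatherable)))
    where
    φ′ = afterStep (enc (copy j b)) (enc (hub i)) φ
    open IsStep (IsStep-enc {φ} {φ′} {copy j b} {hub i}
                  (afterStep-isStep φ (copy≢hub ∘ enc-injective {copy j b} {hub i})))
    1≤⌊x′/2⌋ : 1 ≤ ⌊ φ′ at hub i /2⌋
    1≤⌊x′/2⌋ rewrite target = 1≤n⇒1≤⌊1+n/2⌋ 1≤x
    1≤pk′ : 1 ≤ pairs φ′ k
    1≤pk′ = subst (1 ≤_) (sym (sumFin-cong m λ b′ → cong ⌊_/2⌋
              (others (copy k b′) (λ { refl → Frame-k≢j fr refl }) copy≢hub))) 1≤pk
    two≤gatherable : ⌊ φ′ at hub i /2⌋ + pairs φ′ k ≤ gatherable φ′ j i k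
    two≤gatherable =
      ≤-trans (m≤m+n _ (φ′ at hub j + ⌊ φ′ at hub k /2⌋ + pairs φ′ i))
        (≤-reflexive (solve 5 (λ y h h′ p p′ → h :+ p′ :+ (y :+ h′ :+ p) := y :+ (h :+ h′ :+ (p :+ p′))) refl
                       (φ′ at hub j) ⌊ φ′ at hub i /2⌋ ⌊ φ′ at hub k /2⌋ (pairs φ′ i) (pairs φ′ k)))

  ungatherable-copy-size : Frame i j k → ∀ a φ → φ at copy i a ≡ 0 →
    gatherable φ j i k ≤ 1 → gatherable φ k i j ≤ 1 → ¬ (1 ≤ φ at hub i × 1 ≤ pairs φ j × 1 ≤ pairs φ k) →
    size φ ≤ N
  ungatherable-copy-size {i} {j} {k} fr a φ target≡0 gj≤1 gk≤1 ¬via = ≤-pred (begin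
    suc (size φ)
      ≡⟨ cong suc (size≡hubsAndPairs+odds fr φ) ⟩
    suc (hubsAndPairs φ i j k + (odds φ i + odds φ j + odds φ k))
      ≡⟨ sym (+-suc _ _) ⟩
    hubsAndPairs φ i j k + suc (odds φ i + odds φ j + odds φ k)
      ≤⟨ +-mono-≤ (≤-trans (hubsAndPairs≤gatherable-parity φ i j k) (+-mono-≤ (+-mono-≤ gj≤1 gk≤1) bits≤2))
                  (+-mono-≤ (+-mono-≤ odds-i<m (odds≤m φ j)) (odds≤m φ k)) ⟩
    4 + (m + m + m)
      ≡⟨ cong (4 +_) (solve 1 (λ m → m :+ m :+ m := con 3 :* m) refl m) ⟩
    suc N ∎)
    where
    open ≤-Reasoning
    x = φ at hub i
    odds-i<m : odds φ i < m
    odds-i<m = sumFin-≤1-with-hole m _ a (λ b → parity≤1 (φ at copy i b)) (cong parity target≡0)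
    bits≤2 : parity x + pairs φ j + pairs φ k ≤ 2
    bits≤2 = bits-sum≤2 (parity≤1 x)
      (≤-trans (≤-trans (m≤n+m _ (pairs φ i)) (≤-trans (m≤n+m _ (⌊ x /2⌋ + _)) (m≤n+m _ (φ at hub k)))) gk≤1)
      (≤-trans (≤-trans (m≤n+m _ (pairs φ i)) (≤-trans (m≤n+m _ (⌊ x /2⌋ + _)) (m≤n+m _ (φ at hub j)))) gj≤1)
      (λ { (1≤px , 1≤pj , 1≤pk) → ¬via (≤-trans 1≤px (parity≤n x) , 1≤pj , 1≤pk) })

  copy-upper : Frame i j k → ∀ a φ → size φ ≡ suc N → Solvable G⋆ (enc (copy i a)) φ
  copy-upper {i} {j} {k} fr a φ size≡
    with 1 ≤? φ at copy i a | 2 ≤? gatherable φ j i k | 2 ≤? gatherable φ k i j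
       | 1 ≤? φ at hub i ×-dec (1 ≤? pairs φ j ×-dec 1 ≤? pairs φ k)
  ... | yes 1≤ | _      | _      | _ = φ , ε , 1≤
  ... | no _   | yes 2≤ | _      | _ =
    Reach⇒Solvable G⋆ (adj-enc (G→H (Frame-j≢i fr))) (gather-hub (Frame-transpose fr) φ 2 2≤)
  ... | no _   | no _   | yes 2≤ | _ =
    Reach⇒Solvable G⋆ (adj-enc (G→H (Frame-k≢i fr))) (gather-hub (Frame-transpose (Frame-swap fr)) φ 2 2≤)
  ... | no _   | no _   | no _   | yes (1≤x , 1≤pj , 1≤pk) = copy-via-hub fr a φ 1≤x 1≤pj 1≤pk
  ... | no 1≰r | no 2≰j | no 2≰k | no ¬via =
    ⊥-elim (1+n≰n (subst (_≤ N) size≡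
      (ungatherable-copy-size fr a φ (n≤0⇒n≡0 (≮⇒≥ 1≰r)) (≮⇒≥ 2≰j) (≮⇒≥ 2≰k) ¬via)))

  -- The extremal configuration

  copy-≢ : ∀ {c c′ b b′} → c ≢ c′ → _≢_ {A = V} (copy c b) (copy c′ b′)
  copy-≢ c≢c′ refl = c≢c′ refl

  copy-≢′ : ∀ {c b b′} → b ≢ b′ → _≢_ {A = V} (copy c b) (copy c b′)
  copy-≢′ b≢b′ refl = b≢b′ refl

  hub-≢ : ∀ {p q} → p ≢ q → _≢_ {A = V} (hub p) (hub q)
  hub-≢ p≢q refl = p≢q refl

  record Invariant (i j k : Fin 3) (a : Fin m) (f : V → ℕ) : Set where
    field
      target-empty : f (copy i a) ≡ 0
      copy-i≤1     : ∀ b → f (copy i b) ≤ 1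
      peak-j       : Fin m
      copy-j≤1     : ∀ b → b ≢ peak-j → f (copy j b) ≤ 1
      peak-k       : Fin m
      copy-k≤1     : ∀ b → b ≢ peak-k → f (copy k b) ≤ 1
      safe         : Safe (f (hub i)) (f (hub j)) (f (hub k)) (f (copy j peak-j) ∸ 1) (f (copy k peak-k) ∸ 1)

  Invariant-swap : ∀ {i j k a f} → Invariant i j k a f → Invariant i k j a f
  Invariant-swap I = record
    { target-empty = target-empty ; copy-i≤1 = copy-i≤1
    ; peak-j = peak-k ; copy-j≤1 = copy-k≤1 ; peak-k = peak-j ; copy-k≤1 = copy-j≤1
    ; safe = Safe-swap safe }
    where open Invariant I

  Invariant-≗ : ∀ {i j k a f g} → (∀ x → f x ≡ g x) → Invariant i j k a f → Invariant i j k a g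
  Invariant-≗ {i} {j} {k} {a} f≗g I = record
    { target-empty = trans (sym (f≗g (copy i a))) target-empty
    ; copy-i≤1 = λ b → subst (_≤ 1) (f≗g _) (copy-i≤1 b)
    ; peak-j = peak-j ; copy-j≤1 = λ b b≢ → subst (_≤ 1) (f≗g _) (copy-j≤1 b b≢)
    ; peak-k = peak-k ; copy-k≤1 = λ b b≢ → subst (_≤ 1) (f≗g _) (copy-k≤1 b b≢)
    ; safe = Safe-resp (f≗g _) (f≗g _) (f≗g _) (cong (_∸ 1) (f≗g _)) (cong (_∸ 1) (f≗g _)) safe }
    where open Invariant I

  -- The five kinds of steps that are possible up to the symmetry j ↔ k.
  module Moves {i j k a} (fr : Frame i j k) {f f′ : V → ℕ} (I : Invariant i j k a f) where
    open Invariant I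

    stays≤1 : ∀ {du dv} → IsStep f f′ du dv → ∀ x → x ≢ du → x ≢ dv → f x ≤ 1 → f′ x ≤ 1
    stays≤1 step x x≢u x≢v = subst (_≤ 1) (sym (IsStep.others step x x≢u x≢v))

    peak-j≤3 : f (copy j peak-j) ∸ 1 ≤ 2
    peak-j≤3 = ≮⇒≥ λ 3≤ → Safe-surplus≤2 3≤ safe

    hub-i→hub-j : IsStep f f′ (hub i) (hub j) → 2 ≤ f (hub i) → Invariant i j k a f′
    hub-i→hub-j step 2≤ = record
      { target-empty = trans (others _ copy≢hub copy≢hub) target-empty
      ; copy-i≤1 = λ b → stays≤1 step _ copy≢hub copy≢hub (copy-i≤1 b)
      ; peak-j = peak-j ; copy-j≤1 = λ b b≢ → stays≤1 step _ copy≢hub copy≢hub (copy-j≤1 b b≢)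
      ; peak-k = peak-k ; copy-k≤1 = λ b b≢ → stays≤1 step _ copy≢hub copy≢hub (copy-k≤1 b b≢)
      ; safe = Safe-resp (sym source) (sym target) (sym (others _ (hub-≢ (Frame-k≢i fr)) (hub-≢ (Frame-k≢j fr))))
                         (cong (_∸ 1) (sym (others _ copy≢hub copy≢hub)))
                         (cong (_∸ 1) (sym (others _ copy≢hub copy≢hub)))
                         (Safe-hub→hub 2≤ safe) }
      where open IsStep step

    hub-i→copy-j : ∀ b₀ → IsStep f f′ (hub i) (copy j b₀) → 2 ≤ f (hub i) → Invariant i j k a f′
    hub-i→copy-j b₀ step 2≤ = record
      { target-empty = trans (others _ copy≢hub (copy-≢ (Frame-i≢j fr))) target-empty
      ; copy-i≤1 = λ b → stays≤1 step _ copy≢hub (copy-≢ (Frame-i≢j fr)) (copy-i≤1 b)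
      ; peak-j = b₀ ; copy-j≤1 = λ b b≢ → stays≤1 step _ copy≢hub (copy-≢′ b≢) (all-copy-j≤1 b)
      ; peak-k = peak-k ; copy-k≤1 = λ b b≢ → stays≤1 step _ copy≢hub (copy-≢ (Frame-k≢j fr)) (copy-k≤1 b b≢)
      ; safe = Safe-resp (sym source) (sym (others _ (hub-≢ (Frame-j≢i fr)) hub≢copy))
                         (sym (others _ (hub-≢ (Frame-k≢i fr)) hub≢copy))
                         (cong (_∸ 1) (sym target))
                         (cong (_∸ 1) (sym (others _ copy≢hub (copy-≢ (Frame-k≢j fr)))))
                         (Safe-≤ (all-copy-j≤1 b₀) (Safe-hub→copy 2≤ safe)) }
      where
      open IsStep step
      all-copy-j≤1 : ∀ b → f (copy j b) ≤ 1
      all-copy-j≤1 b with b ≟ peak-j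
      ... | yes refl = ∸1≡0⇒≤1 _ (Safe-hub-pair 2≤ safe)
      ... | no b≢    = copy-j≤1 b b≢

    copy-j→copy-j : ∀ b₀ → b₀ ≢ peak-j → IsStep f f′ (copy j peak-j) (copy j b₀) → 2 ≤ f (copy j peak-j) →
                    Invariant i j k a f′
    copy-j→copy-j b₀ b₀≢ step 2≤ = record
      { target-empty = trans (others _ (copy-≢ (Frame-i≢j fr)) (copy-≢ (Frame-i≢j fr))) target-empty
      ; copy-i≤1 = λ b → stays≤1 step _ (copy-≢ (Frame-i≢j fr)) (copy-≢ (Frame-i≢j fr)) (copy-i≤1 b)
      ; peak-j = b₀ ; copy-j≤1 = copy-j≤1′
      ; peak-k = peak-k
      ; copy-k≤1 = λ b b≢ → stays≤1 step _ (copy-≢ (Frame-k≢j fr)) (copy-≢ (Frame-k≢j fr)) (copy-k≤1 b b≢)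
      ; safe = Safe-resp (sym (others _ hub≢copy hub≢copy)) (sym (others _ hub≢copy hub≢copy))
                         (sym (others _ hub≢copy hub≢copy)) (cong (_∸ 1) (sym target))
                         (cong (_∸ 1) (sym (others _ (copy-≢ (Frame-k≢j fr)) (copy-≢ (Frame-k≢j fr)))))
                         (Safe-≤ (≤-trans (copy-j≤1 b₀ b₀≢) (2≤n⇒1≤n∸1 2≤)) safe) }
      where
      open IsStep step
      copy-j≤1′ : ∀ b → b ≢ b₀ → f′ (copy j b) ≤ 1
      copy-j≤1′ b b≢b₀ with b ≟ peak-j
      ... | yes refl = subst (_≤ 1) (sym source) (n∸1≤2⇒n∸2≤1 (f (copy j peak-j)) peak-j≤3)
      ... | no b≢    = stays≤1 step _ (copy-≢′ b≢) (copy-≢′ b≢b₀) (copy-j≤1 b b≢)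

    copy-j→hub-i : IsStep f f′ (copy j peak-j) (hub i) → 2 ≤ f (copy j peak-j) → Invariant i j k a f′
    copy-j→hub-i step 2≤ = record
      { target-empty = trans (others _ (copy-≢ (Frame-i≢j fr)) copy≢hub) target-empty
      ; copy-i≤1 = λ b → stays≤1 step _ (copy-≢ (Frame-i≢j fr)) copy≢hub (copy-i≤1 b)
      ; peak-j = peak-j ; copy-j≤1 = λ b b≢ → stays≤1 step _ (copy-≢′ b≢) copy≢hub (copy-j≤1 b b≢)
      ; peak-k = peak-k
      ; copy-k≤1 = λ b b≢ → stays≤1 step _ (copy-≢ (Frame-k≢j fr)) copy≢hub (copy-k≤1 b b≢)
      ; safe = Safe-resp (sym target) (sym (others _ hub≢copy (hub-≢ (Frame-j≢i fr))))
                         (sym (others _ hub≢copy (hub-≢ (Frame-k≢i fr))))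
                         (sym (trans (cong (_∸ 1) source) (n∸1≤2⇒n∸2∸1≡0 (f (copy j peak-j)) peak-j≤3)))
                         (cong (_∸ 1) (sym (others _ (copy-≢ (Frame-k≢j fr)) copy≢hub)))
                         (Safe-copy→hub (2≤n⇒1≤n∸1 2≤) safe) }
      where open IsStep step

    copy-j→hub-k : IsStep f f′ (copy j peak-j) (hub k) → 2 ≤ f (copy j peak-j) → Invariant i j k a f′
    copy-j→hub-k step 2≤ = record
      { target-empty = trans (others _ (copy-≢ (Frame-i≢j fr)) copy≢hub) target-empty
      ; copy-i≤1 = λ b → stays≤1 step _ (copy-≢ (Frame-i≢j fr)) copy≢hub (copy-i≤1 b)
      ; peak-j = peak-j ; copy-j≤1 = λ b b≢ → stays≤1 step _ (copy-≢′ b≢) copy≢hub (copy-j≤1 b b≢)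
      ; peak-k = peak-k
      ; copy-k≤1 = λ b b≢ → stays≤1 step _ (copy-≢ (Frame-k≢j fr)) copy≢hub (copy-k≤1 b b≢)
      ; safe = Safe-resp (sym (others _ hub≢copy (hub-≢ (Frame-i≢k fr))))
                         (sym (others _ hub≢copy (hub-≢ (Frame-j≢k fr)))) (sym target)
                         (sym (trans (cong (_∸ 1) source) (n∸1≤2⇒n∸2∸1≡0 (f (copy j peak-j)) peak-j≤3)))
                         (cong (_∸ 1) (sym (others _ (copy-≢ (Frame-k≢j fr)) copy≢hub)))
                         (Safe-copy→other-hub (2≤n⇒1≤n∸1 2≤) safe) }
      where open IsStep step

  Invariant-step : ∀ {i j k a f f′} → Frame i j k → Invariant i j k a f → ∀ {du dv} → CoronaAdj (K 3) H du dv →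
             2 ≤ f du → IsStep f f′ du dv → Invariant i j k a f′
  Invariant-step fr I (inG {p} {q} p≢q) 2≤ step with Frame-cover fr p
  ... | inj₂ (inj₁ refl) = ⊥-elim (Safe-no-pair-j 2≤ (Invariant.safe I))
  ... | inj₂ (inj₂ refl) = ⊥-elim (Safe-no-pair-k 2≤ (Invariant.safe I))
  ... | inj₁ refl with Frame-cover fr q
  ...   | inj₁ refl        = ⊥-elim (p≢q refl)
  ...   | inj₂ (inj₁ refl) = Moves.hub-i→hub-j fr I step 2≤
  ...   | inj₂ (inj₂ refl) = Invariant-swap (Moves.hub-i→hub-j (Frame-swap fr) (Invariant-swap I) step 2≤)
  Invariant-step fr I (G→H {p} {c} {b} p≢c) 2≤ step with Frame-cover fr p
  ... | inj₂ (inj₁ refl) = ⊥-elim (Safe-no-pair-j 2≤ (Invariant.safe I))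
  ... | inj₂ (inj₂ refl) = ⊥-elim (Safe-no-pair-k 2≤ (Invariant.safe I))
  ... | inj₁ refl with Frame-cover fr c
  ...   | inj₁ refl        = ⊥-elim (p≢c refl)
  ...   | inj₂ (inj₁ refl) = Moves.hub-i→copy-j fr I b step 2≤
  ...   | inj₂ (inj₂ refl) = Invariant-swap (Moves.hub-i→copy-j (Frame-swap fr) (Invariant-swap I) b step 2≤)
  Invariant-step fr I (inH {c} {b} {b′} bb′) 2≤ step with Frame-cover fr c
  ... | inj₁ refl = ⊥-elim (1+n≰n (≤-trans 2≤ (Invariant.copy-i≤1 I b)))
  ... | inj₂ (inj₁ refl) with b ≟ Invariant.peak-j I
  ...   | no b≢    = ⊥-elim (1+n≰n (≤-trans 2≤ (Invariant.copy-j≤1 I b b≢)))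
  ...   | yes refl = Moves.copy-j→copy-j fr I b′ (λ { refl → irrefl H bb′ }) step 2≤
  Invariant-step fr I (inH {c} {b} {b′} bb′) 2≤ step | inj₂ (inj₂ refl) with b ≟ Invariant.peak-k I
  ...   | no b≢    = ⊥-elim (1+n≰n (≤-trans 2≤ (Invariant.copy-k≤1 I b b≢)))
  ...   | yes refl =
    Invariant-swap (Moves.copy-j→copy-j (Frame-swap fr) (Invariant-swap I) b′ (λ { refl → irrefl H bb′ }) step 2≤)
  Invariant-step fr I (H→G {p} {c} {b} p≢c) 2≤ step with Frame-cover fr c
  ... | inj₁ refl = ⊥-elim (1+n≰n (≤-trans 2≤ (Invariant.copy-i≤1 I b)))
  ... | inj₂ (inj₁ refl) with b ≟ Invariant.peak-j I
  ...   | no b≢    = ⊥-elim (1+n≰n (≤-trans 2≤ (Invariant.copy-j≤1 I b b≢)))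
  ...   | yes refl with Frame-cover fr p
  ...     | inj₁ refl        = Moves.copy-j→hub-i fr I step 2≤
  ...     | inj₂ (inj₁ refl) = ⊥-elim (p≢c refl)
  ...     | inj₂ (inj₂ refl) = Moves.copy-j→hub-k fr I step 2≤
  Invariant-step fr I (H→G {p} {c} {b} p≢c) 2≤ step | inj₂ (inj₂ refl) with b ≟ Invariant.peak-k I
  ...   | no b≢    = ⊥-elim (1+n≰n (≤-trans 2≤ (Invariant.copy-k≤1 I b b≢)))
  ...   | yes refl with Frame-cover fr p
  ...     | inj₁ refl        = Invariant-swap (Moves.copy-j→hub-i (Frame-swap fr) (Invariant-swap I) step 2≤)
  ...     | inj₂ (inj₁ refl) = Invariant-swap (Moves.copy-j→hub-k (Frame-swap fr) (Invariant-swap I) step 2≤)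
  ...     | inj₂ (inj₂ refl) = ⊥-elim (p≢c refl)

  Invariant-PebStep : ∀ {i j k a} → Frame i j k → ∀ {φ ψ} → PebStep G⋆ φ ψ →
                      Invariant i j k a (φ ∘ enc) → Invariant i j k a (ψ ∘ enc)
  Invariant-PebStep fr {φ} {ψ} s I with PebStep⇒IsStep G⋆ s
  ... | u , v , uv , 2≤φu , step =
    Invariant-step fr I uv (subst (2 ≤_) (cong φ (sym (enc∘dec u))) 2≤φu)
      (IsStep-enc (subst₂ (IsStep φ ψ) (sym (enc∘dec u)) (sym (enc∘dec v)) step))

  extremal : Fin 3 → Fin m → V → ℕ
  extremal i a (hub _)    = 0
  extremal i a (copy c b) = if does (b ≟ a) then (if does (c ≟ i) then 0 else 3) else 1

  extremalConfig : Fin 3 → Fin m → Config N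
  extremalConfig i a = extremal i a ∘ dec

  extremal-target : ∀ i a → extremal i a (copy i a) ≡ 0
  extremal-target i a rewrite dec-true (a ≟ a) refl | dec-true (i ≟ i) refl = refl

  extremal-peak : ∀ {i c} a → c ≢ i → extremal i a (copy c a) ≡ 3
  extremal-peak {i} {c} a c≢i rewrite dec-true (a ≟ a) refl | dec-false (c ≟ i) c≢i = refl

  extremal-off-target : ∀ i {a} c {b} → b ≢ a → extremal i a (copy c b) ≡ 1
  extremal-off-target i {a} c {b} b≢a rewrite dec-false (b ≟ a) b≢a = refl

  extremal-Invariant : Frame i j k → ∀ a → Invariant i j k a (extremal i a)
  extremal-Invariant {i} {j} {k} fr a = record
    { target-empty = extremal-target i a
    ; copy-i≤1 = copy-i≤1
    ; peak-j = a ; copy-j≤1 = λ b b≢a → ≤-reflexive (extremal-off-target i j b≢a)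
    ; peak-k = a ; copy-k≤1 = λ b b≢a → ≤-reflexive (extremal-off-target i k b≢a)
    ; safe = Safe-resp refl refl refl (cong (_∸ 1) (sym (extremal-peak a (Frame-j≢i fr))))
                                      (cong (_∸ 1) (sym (extremal-peak a (Frame-k≢i fr)))) S00022 }
    where
    copy-i≤1 : ∀ b → extremal i a (copy i b) ≤ 1
    copy-i≤1 b with b ≟ a
    ... | yes refl rewrite dec-true (i ≟ i) refl = z≤n
    ... | no _     = s≤s z≤n

  extremal-copySum : ∀ i a c → sumFin m (λ b → extremal i a (copy c b)) + 1 ≡ m + extremal i a (copy c a)
  extremal-copySum i a c =
    trans (sumFin-update m _ (λ _ → 1) a (λ b b≢a → extremal-off-target i c b≢a))
          (cong (_+ extremal i a (copy c a)) (trans (sumFin-const m 1) (*-identityʳ m)))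

  extremal-size : Frame i j k → ∀ a → size (extremalConfig i a) ≡ N
  extremal-size {i} {j} {k} fr a = begin
    size φ₀
      ≡⟨ size-Frame fr φ₀ ⟩
    (φ₀ at hub i + φ₀ at hub j + φ₀ at hub k) + (copySum φ₀ i + copySum φ₀ j + copySum φ₀ k)
      ≡⟨ cong₂ _+_ (cong₂ _+_ (cong₂ _+_ (hub-empty i) (hub-empty j)) (hub-empty k))
                   (cong₂ _+_ (cong₂ _+_ (copySum≡ i) (copySum≡ j)) (copySum≡ k)) ⟩
    0 + (Σ i + Σ j + Σ k)
      ≡⟨ +-cancelʳ-≡ 3 _ _ (begin
           Σ i + Σ j + Σ k + 3
             ≡⟨ solve 3 (λ p q r → p :+ q :+ r :+ con 3 := (p :+ con 1) :+ (q :+ con 1) :+ (r :+ con 1))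
                        refl (Σ i) (Σ j) (Σ k) ⟩
           (Σ i + 1) + (Σ j + 1) + (Σ k + 1)
             ≡⟨ cong₂ _+_ (cong₂ _+_ (extremal-copySum i a i) (extremal-copySum i a j)) (extremal-copySum i a k) ⟩
           (m + extremal i a (copy i a)) + (m + extremal i a (copy j a)) + (m + extremal i a (copy k a))
             ≡⟨ cong₂ _+_ (cong₂ _+_ (cong (m +_) (extremal-target i a))
                                     (cong (m +_) (extremal-peak a (Frame-j≢i fr))))
                          (cong (m +_) (extremal-peak a (Frame-k≢i fr))) ⟩
           (m + 0) + (m + 3) + (m + 3)
             ≡⟨ solve 1 (λ m → (m :+ con 0) :+ (m :+ con 3) :+ (m :+ con 3) := con 3 :+ con 3 :* m :+ con 3) refl m ⟩
           N + 3 ∎) ⟩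
    N ∎
    where
    open ≡-Reasoning
    φ₀ = extremalConfig i a
    Σ : Fin 3 → ℕ
    Σ c = sumFin m (λ b → extremal i a (copy c b))
    hub-empty : ∀ p → φ₀ at hub p ≡ 0
    hub-empty p = cong (extremal i a) (dec∘enc (hub p))
    copySum≡ : ∀ c → copySum φ₀ c ≡ Σ c
    copySum≡ c = sumFin-cong m (λ b → cong (extremal i a) (dec∘enc (copy c b)))

  extremal-unsolvable : Frame i j k → ∀ a → ¬ Solvable G⋆ (enc (copy i a)) (extremalConfig i a)
  extremal-unsolvable {i} {j} {k} fr a =
    unsolvable-by-invariant G⋆ (enc (copy i a)) (λ φ → Invariant i j k a (φ ∘ enc))
      (Invariant-PebStep fr) Invariant.target-empty
      (Invariant-≗ (λ x → sym (cong (extremal i a) (dec∘enc x))) (extremal-Invariant fr a))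

  π-hub : Frame i j k → IsPebblingNumberAt G⋆ (enc (hub i)) N
  π-hub fr = s≤s z≤n , hub-upper fr , λ n _ n<N → unsolvable-below G⋆ _ n n<N

  π-copy : Frame i j k → ∀ a → IsPebblingNumberAt G⋆ (enc (copy i a)) (suc N)
  π-copy {i} fr a = s≤s z≤n , copy-upper fr a , below
    where
    below : ∀ n → 1 ≤ n → n < suc N → ∃ λ φ → size φ ≡ n × ¬ Solvable G⋆ (enc (copy i a)) φ
    below n _ n<1+N with n ℕ.≟ N
    ... | yes refl = extremalConfig i a , extremal-size fr a , extremal-unsolvable fr a
    ... | no n≢N   = unsolvable-below G⋆ _ n (≤∧≢⇒< (≤-pred n<1+N) n≢N)

  class1 : Fin m → Class1 G⋆
  class1 a = every-target , enc (copy #0 a) , π-copy f012 a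
    where
    every-target : ∀ r → ∃ λ q → IsPebblingNumberAt G⋆ r q × q ≤ suc N
    every-target r with dec r | enc∘dec r
    ... | hub p    | refl with Frame-for p
    ...   | _ , _ , fr = N , π-hub fr , n≤1+n N
    every-target r | copy c b | refl with Frame-for c
    ...   | _ , _ , fr = suc N , π-copy fr b , ≤-refl

mainTheorem8 : ∀ (m : ℕ) → 1 ≤ m → (H : Graph m) → Class1 (K 3 ⋆ H)
mainTheorem8 (suc m) _ H = Corona.class1 (suc m) H zero
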